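{- Let $h\ge1$, $t_1,s_1,\dots,t_h,s_h$ be positive integers, and let $G$ be the chain graph generated by $b=(0^{t_1}1^{s_1})\cdots(0^{t_h}1^{s_h})$. If $G$ is Hamiltonian, then every key edge of $G$ lies in at least one Hamilton cycle of $G$.
   Context: For a binary sequence $b=(b_1\cdots b_n)$ the chain graph generated by $b$ has vertex set $\{1,\dots,n\}$, and for $i<j$ the vertices $i,j$ are adjacent iff $b_i=0$ and $b_j=1$. Notation $0^{t}$ / $1^{s}$ denotes a run of $t$ zeros / $s$ ones. Let $U_i$ be the set of vertices of the $i$-th run of zeros and $V_i$ the set of vertices of the $i$-th run of ones. A key edge is an edge joining a vertex of $U_i$ to a vertex of $V_i$ for some $1\le i\le h$. A Hamilton cycle is a cycle through all vertices; a graph is Hamiltonian if it has one. -}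

module Defs where

open import Data.Nat using (ℕ; zero; suc; _≤_)
open import Data.Nat.DivMod using (_mod_)
open import Data.Fin using (Fin; toℕ; _<_)
open import Data.Bool using (Bool; true; false)
open import Data.List using (List; []; _∷_; _++_; replicate; concatMap; length; lookup; map)
open import Data.List.Base using (allFin)
open import Data.Product using (_×_; _,_; proj₁; proj₂; ∃)
open import Data.Sum using (_⊎_)
open import Relation.Binary.PropositionalEquality using (_≡_)
open import Function.Definitions using (Injective)

-- Labelled sequence (0^{t_1} 1^{s_1}) ... (0^{t_h} 1^{s_h}): each position carries
-- the index i of its block (0-based, Fin h) and its bit (false = 0, true = 1).
labels : (h : ℕ) → (Fin h → ℕ) → (Fin h → ℕ) → List (Fin h × Bool)
labels h t s = concatMap (λ i → replicate (t i) (i , false) ++ replicate (s i) (i , true)) (allFin h)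

nV : (h : ℕ) → (Fin h → ℕ) → (Fin h → ℕ) → ℕ
nV h t s = length (labels h t s)

-- vertices are Fin n (position 0 .. n-1, i.e. the paper's vertex k+1)
Vtx : (h : ℕ) → (Fin h → ℕ) → (Fin h → ℕ) → Set
Vtx h t s = Fin (nV h t s)

bit : (h : ℕ) (t s : Fin h → ℕ) → Vtx h t s → Bool
bit h t s v = proj₂ (lookup (labels h t s) v)

block : (h : ℕ) (t s : Fin h → ℕ) → Vtx h t s → Fin h
block h t s v = proj₁ (lookup (labels h t s) v)

Adj : (h : ℕ) (t s : Fin h → ℕ) → Vtx h t s → Vtx h t s → Set
Adj h t s u v =
  (u < v × bit h t s u ≡ false × bit h t s v ≡ true)
  ⊎ (v < u × bit h t s v ≡ false × bit h t s u ≡ true)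

InU : (h : ℕ) (t s : Fin h → ℕ) → Fin h → Vtx h t s → Set
InU h t s i v = block h t s v ≡ i × bit h t s v ≡ false

InV : (h : ℕ) (t s : Fin h → ℕ) → Fin h → Vtx h t s → Set
InV h t s i v = block h t s v ≡ i × bit h t s v ≡ true

KeyEdge : (h : ℕ) (t s : Fin h → ℕ) → Vtx h t s → Vtx h t s → Set
KeyEdge h t s u v = ∃ λ (i : Fin h) → InU h t s i u × InV h t s i v

cnext : ∀ {n} → Fin n → Fin n
cnext {zero} ()
cnext {suc m} k = suc (toℕ k) mod suc m

record HamCycle {n : ℕ} (A : Fin n → Fin n → Set) : Set where
  field
    three≤n : 3 ≤ n
    cyc     : Fin n → Fin n
    inj     : Injective _≡_ _≡_ cyc
    adj     : ∀ k → A (cyc k) (cyc (cnext k))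

EdgeOf : ∀ {n} {A : Fin n → Fin n → Set} → HamCycle A → Fin n → Fin n → Set
EdgeOf C u v = ∃ λ k →
  (HamCycle.cyc C k ≡ u × HamCycle.cyc C (cnext k) ≡ v)
  ⊎ (HamCycle.cyc C k ≡ v × HamCycle.cyc C (cnext k) ≡ u)

-- Along the vertex order the labels (block, bit) increase lexicographically, which is
-- recorded by the rank 2·block + bit. Let uv be a key edge with u ∈ U_i, v ∈ V_i, and
-- let a, b be the predecessors of v and u on a Hamilton cycle. Every neighbour of v is
-- a zero in a block ≤ i and every neighbour of u is a one in a block ≥ i, so a precedes
-- b and ab is an edge. Replacing the cycle edges av and bu by ab and uv, i.e. reversing
-- the stretch of the cycle between them, gives a Hamilton cycle through uv.
module Submission where

open import Data.Bool using (Bool; true; false)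
open import Data.Fin using (Fin; toℕ; fromℕ; fromℕ<; inject₁; punchOut)
  renaming (zero to fzero; suc to fsuc)
open import Data.Fin.Properties
  using (toℕ-injective; toℕ-fromℕ<; toℕ-fromℕ; toℕ-inject₁; toℕ<n; any?; punchOut-injective; injective⇒≤)
  renaming (_≟_ to _≟ᶠ_)
open import Data.List using (List; []; _∷_; _++_; replicate; concatMap; length; lookup; tabulate)
open import Data.Nat using (ℕ; zero; suc; _+_; _∸_; _≤_; _<_; z≤n; s≤s; s≤s⁻¹; _≟_; _≤?_; _<?_; _%_; ⌊_/2⌋)
open import Data.Nat.DivMod using (m<n⇒m%n≡m; n%n≡0)
open import Data.Nat.Properties
open import Data.Product using (Σ; ∃; _×_; _,_; proj₁; proj₂)
open import Data.Sum using (_⊎_; inj₁; inj₂; swap)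
open import Function using (_∘_; id)
open import Function.Definitions using (Injective)
open import Relation.Binary using (Symmetric; tri<; tri≈; tri>)
open import Relation.Binary.PropositionalEquality
open import Relation.Nullary using (¬_; yes; no; contradiction)

open import Defs

data Ascending {A : Set} (κ : A → ℕ) : ℕ → ℕ → List A → Set where
  done : ∀ {lo hi} → lo ≤ hi → Ascending κ lo hi []
  _∷_  : ∀ {lo hi x xs} → lo ≤ κ x → Ascending κ (κ x) hi xs → Ascending κ lo hi (x ∷ xs)

module _ {A : Set} {κ : A → ℕ} where

  ascending-weaken : ∀ {lo lo′ hi xs} → lo ≤ lo′ → Ascending κ lo′ hi xs → Ascending κ lo hi xs
  ascending-weaken lo≤lo′ (done lo′≤hi) = done (≤-trans lo≤lo′ lo′≤hi)
  ascending-weaken lo≤lo′ (lo′≤x ∷ xs↗) = ≤-trans lo≤lo′ lo′≤x ∷ xs↗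

  ascending-++ : ∀ {lo mid hi xs ys} →
    Ascending κ lo mid xs → Ascending κ mid hi ys → Ascending κ lo hi (xs ++ ys)
  ascending-++ (done lo≤mid) ys↗ = ascending-weaken lo≤mid ys↗
  ascending-++ (lo≤x ∷ xs↗)  ys↗ = lo≤x ∷ ascending-++ xs↗ ys↗

  ascending-replicate : ∀ {lo hi x} n → lo ≤ κ x → κ x ≤ hi → Ascending κ lo hi (replicate n x)
  ascending-replicate zero    lo≤x x≤hi = done (≤-trans lo≤x x≤hi)
  ascending-replicate (suc n) lo≤x x≤hi = lo≤x ∷ ascending-replicate n ≤-refl x≤hi

  ascending-concatMap : ∀ {B : Set} {h} (β : ℕ → ℕ) (F : B → List A) (g : Fin h → B) →
    (∀ i → Ascending κ (β (toℕ i)) (β (suc (toℕ i))) (F (g i))) →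
    Ascending κ (β 0) (β h) (concatMap F (tabulate g))
  ascending-concatMap {h = zero}  β F g F↗ = done ≤-refl
  ascending-concatMap {h = suc h} β F g F↗ =
    ascending-++ (F↗ fzero) (ascending-concatMap (β ∘ suc) F (g ∘ fsuc) (F↗ ∘ fsuc))

  ascending-lookup-≥ : ∀ {lo hi xs} → Ascending κ lo hi xs → (i : Fin (length xs)) → lo ≤ κ (lookup xs i)
  ascending-lookup-≥ (lo≤x ∷ xs↗) fzero    = lo≤x
  ascending-lookup-≥ (lo≤x ∷ xs↗) (fsuc i) = ≤-trans lo≤x (ascending-lookup-≥ xs↗ i)

  ascending-lookup-mono : ∀ {lo hi xs} → Ascending κ lo hi xs → (i j : Fin (length xs)) →
    toℕ i ≤ toℕ j → κ (lookup xs i) ≤ κ (lookup xs j)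
  ascending-lookup-mono (_ ∷ xs↗) fzero    fzero    _         = ≤-refl
  ascending-lookup-mono (_ ∷ xs↗) fzero    (fsuc j) _         = ascending-lookup-≥ xs↗ j
  ascending-lookup-mono (_ ∷ xs↗) (fsuc i) (fsuc j) (s≤s i≤j) = ascending-lookup-mono xs↗ i j i≤j

rank : ∀ {h} → Fin h × Bool → ℕ
rank (i , false) = toℕ i + toℕ i
rank (i , true)  = suc (toℕ i + toℕ i)

rank-zero : ∀ {h} (l : Fin h × Bool) → proj₂ l ≡ false → rank l ≡ toℕ (proj₁ l) + toℕ (proj₁ l)
rank-zero (i , false) refl = refl

rank-one : ∀ {h} (l : Fin h × Bool) → proj₂ l ≡ true → rank l ≡ suc (toℕ (proj₁ l) + toℕ (proj₁ l))
rank-one (i , true) refl = refl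

⌊rank/2⌋≡proj₁ : ∀ {h} (l : Fin h × Bool) → ⌊ rank l /2⌋ ≡ toℕ (proj₁ l)
⌊rank/2⌋≡proj₁ (i , false) = sym (n≡⌊n+n/2⌋ (toℕ i))
⌊rank/2⌋≡proj₁ (i , true)  = sym (n≡⌈n+n/2⌉ (toℕ i))

module ChainGraph (h : ℕ) (t s : Fin h → ℕ) where

  labels-ascending : Ascending rank 0 (h + h) (labels h t s)
  labels-ascending = ascending-concatMap (λ k → k + k) _ id block↗
    where
    block↗ : ∀ i → Ascending rank (toℕ i + toℕ i) (suc (toℕ i) + suc (toℕ i))
                     (replicate (t i) (i , false) ++ replicate (s i) (i , true))
    block↗ i = ascending-++ (ascending-replicate (t i) ≤-refl ≤-refl)
                            (ascending-replicate (s i) (n≤1+n _) (s≤s (+-monoʳ-≤ (toℕ i) (n≤1+n (toℕ i)))))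

  rank-mono : ∀ {x y : Vtx h t s} → toℕ x ≤ toℕ y →
    rank (lookup (labels h t s) x) ≤ rank (lookup (labels h t s) y)
  rank-mono = ascending-lookup-mono labels-ascending _ _

  block-mono : ∀ {x y : Vtx h t s} → toℕ x ≤ toℕ y → toℕ (block h t s x) ≤ toℕ (block h t s y)
  block-mono {x} {y} x≤y =
    subst₂ _≤_ (⌊rank/2⌋≡proj₁ (lookup (labels h t s) x)) (⌊rank/2⌋≡proj₁ (lookup (labels h t s) y))
           (⌊n/2⌋-mono (rank-mono x≤y))

  zero-before-one : ∀ {x y : Vtx h t s} → bit h t s x ≡ false → bit h t s y ≡ true →
    toℕ (block h t s x) ≤ toℕ (block h t s y) → toℕ x < toℕ y
  zero-before-one {x} {y} x₀ y₁ bx≤by = ≰⇒> λ y≤x → <⇒≱ rank-x<rank-y (rank-mono y≤x)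
    where
    rank-x<rank-y : rank (lookup (labels h t s) x) < rank (lookup (labels h t s) y)
    rank-x<rank-y = subst₂ _<_ (sym (rank-zero _ x₀)) (sym (rank-one _ y₁)) (s≤s (+-mono-≤ bx≤by bx≤by))

  Adj-sym : Symmetric (Adj h t s)
  Adj-sym (inj₁ u~v) = inj₂ u~v
  Adj-sym (inj₂ u~v) = inj₁ u~v

  Adj-irrefl : ∀ {v} → ¬ Adj h t s v v
  Adj-irrefl (inj₁ (v<v , _)) = <-irrefl refl v<v
  Adj-irrefl (inj₂ (v<v , _)) = <-irrefl refl v<v

  neighbour-of-Vᵢ : ∀ {i a v} → InV h t s i v → Adj h t s a v →
    bit h t s a ≡ false × toℕ (block h t s a) ≤ toℕ i
  neighbour-of-Vᵢ (refl , _)  (inj₁ (a<v , a₀ , _)) = a₀ , block-mono (<⇒≤ a<v)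
  neighbour-of-Vᵢ (_ , v₁) (inj₂ (_ , v₀ , _))      = contradiction (trans (sym v₀) v₁) λ ()

  neighbour-of-Uᵢ : ∀ {i u b} → InU h t s i u → Adj h t s u b →
    bit h t s b ≡ true × toℕ i ≤ toℕ (block h t s b)
  neighbour-of-Uᵢ (refl , _)  (inj₁ (u<b , _ , b₁)) = b₁ , block-mono (<⇒≤ u<b)
  neighbour-of-Uᵢ (_ , u₀) (inj₂ (_ , _ , u₁))      = contradiction (trans (sym u₀) u₁) λ ()

  key-edge-neighbours-adjacent : ∀ {u v a b} → KeyEdge h t s u v →
    Adj h t s a v → Adj h t s u b → Adj h t s a b
  key-edge-neighbours-adjacent (i , u∈Uᵢ , v∈Vᵢ) a~v u~b =
    let a₀ , a≤i = neighbour-of-Vᵢ v∈Vᵢ a~v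
        b₁ , i≤b = neighbour-of-Uᵢ u∈Uᵢ u~b
    in inj₁ (zero-before-one a₀ b₁ (≤-trans a≤i i≤b) , a₀ , b₁)

Next : ℕ → ℕ → ℕ → Set
Next n x y = (suc x < n × y ≡ suc x) ⊎ (suc x ≡ n × y ≡ 0)

Next-functional : ∀ {n x y y′} → Next n x y → Next n x y′ → y ≡ y′
Next-functional (inj₁ (_ , y≡1+x))   (inj₁ (_ , y′≡1+x))  = trans y≡1+x (sym y′≡1+x)
Next-functional (inj₁ (1+x<n , _))   (inj₂ (1+x≡n , _))   = contradiction 1+x≡n (<⇒≢ 1+x<n)
Next-functional (inj₂ (1+x≡n , _))   (inj₁ (1+x<n , _))   = contradiction 1+x≡n (<⇒≢ 1+x<n)
Next-functional (inj₂ (_ , refl))    (inj₂ (_ , refl))    = refl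

Next-injective : ∀ {n x x′ y} → Next n x y → Next n x′ y → x ≡ x′
Next-injective (inj₁ (_ , refl))     (inj₁ (_ , 1+x≡1+x′)) = suc-injective 1+x≡1+x′
Next-injective (inj₂ (1+x≡n , _))    (inj₂ (1+x′≡n , _))   = suc-injective (trans 1+x≡n (sym 1+x′≡n))
Next-injective (inj₁ (_ , refl))     (inj₂ (_ , ()))
Next-injective (inj₂ (_ , refl))     (inj₁ (_ , ()))

Next-nonzero : ∀ {n x y} → Next n x y → 0 < y → y ≡ suc x
Next-nonzero (inj₁ (_ , y≡1+x)) _ = y≡1+x
Next-nonzero (inj₂ (_ , refl))  ()

cnext-Next : ∀ {n} (k : Fin n) → Next n (toℕ k) (toℕ (cnext k))
cnext-Next {suc m} k with suc (toℕ k) <? suc m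
... | yes 1+k<n = inj₁ (1+k<n , trans (toℕ-fromℕ< _) (m<n⇒m%n≡m 1+k<n))
... | no  1+k≮n = inj₂ (1+k≡n , trans (toℕ-fromℕ< _) (trans (cong (_% suc m) 1+k≡n) (n%n≡0 (suc m))))
  where
  1+k≡n : suc (toℕ k) ≡ suc m
  1+k≡n = ≤-antisym (toℕ<n k) (≮⇒≥ 1+k≮n)

cprev : ∀ {n} → Fin n → Fin n
cprev {suc m} fzero    = fromℕ m
cprev {suc m} (fsuc k) = inject₁ k

cprev-Next : ∀ {n} (k : Fin n) → Next n (toℕ (cprev k)) (toℕ k)
cprev-Next {suc m} fzero    = inj₂ (cong suc (toℕ-fromℕ m) , refl)
cprev-Next {suc m} (fsuc k) rewrite toℕ-inject₁ k = inj₁ (toℕ<n (fsuc k) , refl)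

injective⇒surjective : ∀ {n} {f : Fin n → Fin n} → Injective _≡_ _≡_ f → ∀ y → ∃ λ x → f x ≡ y
injective⇒surjective {suc m} {f} f-injective y with any? (λ x → f x ≟ᶠ y)
... | yes hit  = hit
... | no  miss = contradiction (injective⇒≤ g-injective) 1+n≰n
  where
  y≢f : ∀ x → y ≢ f x
  y≢f x y≡fx = miss (x , sym y≡fx)
  g : Fin (suc m) → Fin m
  g x = punchOut (y≢f x)
  g-injective : Injective _≡_ _≡_ g
  g-injective {x} {x′} gx≡gx′ = f-injective (punchOut-injective (y≢f x) (y≢f x′) gx≡gx′)

module SegmentReflection (n L M : ℕ) (L<M : L < M) (M<n : M < n) where

  Mirrored : ℕ → ℕ → Set
  Mirrored x y = suc (x + y) ≡ L + M

  mirrored-sym : ∀ {x y} → Mirrored x y → Mirrored y x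
  mirrored-sym {x} {y} = trans (cong suc (+-comm y x))

  mirrored-unique : ∀ {x x′ y} → Mirrored x y → Mirrored x′ y → x ≡ x′
  mirrored-unique {x} {x′} {y} m m′ = +-cancelʳ-≡ y x x′ (suc-injective (trans m (sym m′)))

  mirrored-< : ∀ {x y} → Mirrored x y → L ≤ y → x < M
  mirrored-< {x} {y} m L≤y = +-cancelʳ-≤ y (suc x) M (begin
    suc x + y ≡⟨ m ⟩
    L + M     ≡⟨ +-comm L M ⟩
    M + L     ≤⟨ +-monoʳ-≤ M L≤y ⟩
    M + y     ∎)
    where open ≤-Reasoning

  mirrored-≥ : ∀ {x y} → Mirrored x y → y < M → L ≤ x
  mirrored-≥ {x} {y} m y<M = +-cancelʳ-≤ (suc y) L x (begin
    L + suc y ≤⟨ +-monoʳ-≤ L y<M ⟩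
    L + M     ≡⟨ sym m ⟩
    suc (x + y) ≡⟨ sym (+-suc x y) ⟩
    x + suc y ∎)
    where open ≤-Reasoning

  data Region (x : ℕ) : Set where
    below  : x < L → Region x
    inside : L ≤ x → x < M → Region x
    above  : M ≤ x → Region x

  region : ∀ x → Region x
  region x with L ≤? x | x <? M
  ... | no  L≰x | _       = below (≰⇒> L≰x)
  ... | yes L≤x | yes x<M = inside L≤x x<M
  ... | yes _   | no  x≮M = above (≮⇒≥ x≮M)

  reflect : ℕ → ℕ
  reflect x with region x
  ... | inside _ _ = L + M ∸ suc x
  ... | _          = x

  reflect-below : ∀ {x} → x < L → reflect x ≡ x
  reflect-below {x} x<L with region x
  ... | below _       = refl
  ... | inside L≤x _  = contradiction L≤x (<⇒≱ x<L)
  ... | above _       = refl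

  reflect-above : ∀ {x} → M ≤ x → reflect x ≡ x
  reflect-above {x} M≤x with region x
  ... | below _       = refl
  ... | inside _ x<M  = contradiction M≤x (<⇒≱ x<M)
  ... | above _       = refl

  reflect-inside : ∀ {x} → L ≤ x → x < M → Mirrored (reflect x) x
  reflect-inside {x} L≤x x<M with region x
  ... | below x<L    = contradiction L≤x (<⇒≱ x<L)
  ... | inside _ _   = trans (sym (+-suc (L + M ∸ suc x) x)) (m∸n+n≡m (≤-trans x<M (m≤n+m M L)))
  ... | above M≤x    = contradiction M≤x (<⇒≱ x<M)

  reflect-first : suc (reflect L) ≡ M
  reflect-first = +-cancelʳ-≡ L (suc (reflect L)) M (trans (reflect-inside ≤-refl L<M) (+-comm L M))

  reflect-last : ∀ {x} → suc x ≡ M → reflect x ≡ L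
  reflect-last {x} 1+x≡M =
    mirrored-unique (reflect-inside (s≤s⁻¹ (subst (L <_) (sym 1+x≡M) L<M)) (subst (x <_) 1+x≡M (n<1+n x)))
                    (trans (sym (+-suc L x)) (cong (L +_) 1+x≡M))

  reflect-step : ∀ {x} → L ≤ x → suc x < M → reflect x ≡ suc (reflect (suc x))
  reflect-step {x} L≤x 1+x<M =
    mirrored-unique (reflect-inside L≤x (<-trans (n<1+n x) 1+x<M))
                    (trans (cong suc (sym (+-suc (reflect (suc x)) x)))
                           (reflect-inside (m≤n⇒m≤1+n L≤x) 1+x<M))

  reflect-involutive : ∀ x → reflect (reflect x) ≡ x
  reflect-involutive x = involutive (region x)
    where
    involutive : Region x → reflect (reflect x) ≡ x
    involutive (below x<L)     = trans (cong reflect (reflect-below x<L)) (reflect-below x<L)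
    involutive (above M≤x)     = trans (cong reflect (reflect-above M≤x)) (reflect-above M≤x)
    involutive (inside L≤x x<M) =
      mirrored-unique (reflect-inside (mirrored-≥ m x<M) (mirrored-< m L≤x)) (mirrored-sym {reflect x} m)
      where
      m : Mirrored (reflect x) x
      m = reflect-inside L≤x x<M

  reflect-< : ∀ {x} → x < n → reflect x < n
  reflect-< {x} x<n = bounded (region x)
    where
    bounded : Region x → reflect x < n
    bounded (below x<L)      = subst (_< n) (sym (reflect-below x<L)) x<n
    bounded (above M≤x)      = subst (_< n) (sym (reflect-above M≤x)) x<n
    bounded (inside L≤x x<M) = <-trans (mirrored-< (reflect-inside L≤x x<M) L≤x) M<n

  -- entry and exit are the two steps that the unreflected cycle does not take.
  data Reflected (x y : ℕ) : Set where
    kept     : Next n x y → Reflected x y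
    reversed : Next n y x → Reflected x y
    entry    : Next n x L → suc y ≡ M → Reflected x y
    exit     : x ≡ L → y ≡ M → Reflected x y

  reflected-step : ∀ {x y} → Next n x y → Reflected (reflect x) (reflect y)
  reflected-step {x} (inj₁ (1+x<n , refl)) with <-cmp (suc x) L
  ... | tri< 1+x<L _ _ =
    subst₂ Reflected (sym (reflect-below (<-trans (n<1+n x) 1+x<L))) (sym (reflect-below 1+x<L))
           (kept (inj₁ (1+x<n , refl)))
  ... | tri≈ _ 1+x≡L _ =
    subst (λ z → Reflected z (reflect (suc x))) (sym (reflect-below (subst (x <_) 1+x≡L (n<1+n x))))
          (entry (inj₁ (1+x<n , sym 1+x≡L)) (subst (λ z → suc (reflect z) ≡ M) (sym 1+x≡L) reflect-first))
  ... | tri> _ _ L<1+x with <-cmp (suc x) M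
  ...   | tri< 1+x<M _ _ =
    subst (λ z → Reflected z (reflect (suc x))) (sym (reflect-step (s≤s⁻¹ L<1+x) 1+x<M))
          (reversed (inj₁ (<-≤-trans (s≤s (mirrored-< (reflect-inside L≤1+x 1+x<M) L≤1+x)) M<n , refl)))
    where
    L≤1+x : L ≤ suc x
    L≤1+x = <⇒≤ L<1+x
  ...   | tri≈ _ 1+x≡M _ = exit (reflect-last 1+x≡M) (trans (reflect-above (≤-reflexive (sym 1+x≡M))) 1+x≡M)
  ...   | tri> _ _ M<1+x =
    subst₂ Reflected (sym (reflect-above (s≤s⁻¹ M<1+x))) (sym (reflect-above (<⇒≤ M<1+x)))
           (kept (inj₁ (1+x<n , refl)))
  reflected-step {x} (inj₂ (1+x≡n , refl)) with L ≟ 0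
  ... | yes L≡0 =
    subst (λ z → Reflected z (reflect 0)) (sym (reflect-above M≤x))
          (entry (inj₂ (1+x≡n , L≡0)) (subst (λ z → suc (reflect z) ≡ M) L≡0 reflect-first))
    where
    M≤x : M ≤ x
    M≤x = s≤s⁻¹ (subst (M <_) (sym 1+x≡n) M<n)
  ... | no  L≢0 =
    subst₂ Reflected (sym (reflect-above M≤x)) (sym (reflect-below (n≢0⇒n>0 L≢0)))
           (kept (inj₂ (1+x≡n , refl)))
    where
    M≤x : M ≤ x
    M≤x = s≤s⁻¹ (subst (M <_) (sym 1+x≡n) M<n)

module _ {n : ℕ} {A : Fin n → Fin n → Set} (C : HamCycle A) where
  open HamCycle C

  cycle-edge : ∀ {j k} → Next n (toℕ j) (toℕ k) → A (cyc j) (cyc k)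
  cycle-edge {j} step = subst (A (cyc j) ∘ cyc) (toℕ-injective (Next-functional (cnext-Next j) step)) (adj j)

EdgeOf-sym : ∀ {n} {A : Fin n → Fin n → Set} {C : HamCycle A} {x y} → EdgeOf C x y → EdgeOf C y x
EdgeOf-sym (k , e) = k , swap e

module _ {n : ℕ} {A : Fin n → Fin n → Set} (A-sym : Symmetric A) (C : HamCycle A) where
  open HamCycle C

  reverse-segment : (p q : Fin n) → toℕ p < toℕ q →
    A (cyc (cprev p)) (cyc (cprev q)) → A (cyc p) (cyc q) →
    Σ (HamCycle A) λ D → EdgeOf D (cyc p) (cyc q)
  reverse-segment p q p<q prev~prev p~q = D , cprev q , inj₁ (cong cyc σ-last , cong cyc σ-after-last)
    where
    open SegmentReflection n (toℕ p) (toℕ q) p<q (toℕ<n q)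

    σ : Fin n → Fin n
    σ k = fromℕ< (reflect-< (toℕ<n k))

    toℕ-σ : ∀ k → toℕ (σ k) ≡ reflect (toℕ k)
    toℕ-σ k = toℕ-fromℕ< _

    σ-injective : Injective _≡_ _≡_ σ
    σ-injective {k} {k′} σk≡σk′ = toℕ-injective (begin
      toℕ k                     ≡⟨ sym (reflect-involutive (toℕ k)) ⟩
      reflect (reflect (toℕ k))  ≡⟨ cong reflect (trans (sym (toℕ-σ k)) (trans (cong toℕ σk≡σk′) (toℕ-σ k′))) ⟩
      reflect (reflect (toℕ k′)) ≡⟨ reflect-involutive (toℕ k′) ⟩
      toℕ k′                    ∎)
      where open ≡-Reasoning

    1+prev-q≡q : suc (toℕ (cprev q)) ≡ toℕ q
    1+prev-q≡q = sym (Next-nonzero (cprev-Next q) (≤-<-trans z≤n p<q))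

    reflected-edge : ∀ {j k} → Reflected (toℕ j) (toℕ k) → A (cyc j) (cyc k)
    reflected-edge (kept step)     = cycle-edge C step
    reflected-edge (reversed step) = A-sym (cycle-edge C step)
    reflected-edge (entry step 1+k≡q) =
      subst₂ (λ j k → A (cyc j) (cyc k))
             (toℕ-injective (Next-injective (cprev-Next p) step))
             (toℕ-injective (suc-injective (trans 1+prev-q≡q (sym 1+k≡q))))
             prev~prev
    reflected-edge (exit j≡p k≡q) =
      subst₂ (λ j k → A (cyc j) (cyc k)) (toℕ-injective (sym j≡p)) (toℕ-injective (sym k≡q)) p~q

    D : HamCycle A
    D = record
      { three≤n = three≤n
      ; cyc     = cyc ∘ σ
      ; inj     = σ-injective ∘ inj
      ; adj     = λ k → reflected-edge
          (subst₂ Reflected (sym (toℕ-σ k)) (sym (toℕ-σ (cnext k))) (reflected-step (cnext-Next k)))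
      }

    σ-last : σ (cprev q) ≡ p
    σ-last = toℕ-injective (trans (toℕ-σ (cprev q)) (reflect-last 1+prev-q≡q))

    σ-after-last : σ (cnext (cprev q)) ≡ q
    σ-after-last = toℕ-injective (begin
      toℕ (σ (cnext (cprev q))) ≡⟨ toℕ-σ (cnext (cprev q)) ⟩
      reflect (toℕ (cnext (cprev q))) ≡⟨ cong reflect (Next-functional (cnext-Next (cprev q)) (cprev-Next q)) ⟩
      reflect (toℕ q)           ≡⟨ reflect-above ≤-refl ⟩
      toℕ q                     ∎)
      where open ≡-Reasoning

  two-opt : (p q : Fin n) → p ≢ q →
    A (cyc (cprev p)) (cyc (cprev q)) → A (cyc p) (cyc q) →
    Σ (HamCycle A) λ D → EdgeOf D (cyc p) (cyc q)
  two-opt p q p≢q prev~prev p~q with <-cmp (toℕ p) (toℕ q)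
  ... | tri< p<q _ _ = reverse-segment p q p<q prev~prev p~q
  ... | tri≈ _ p≡q _ = contradiction (toℕ-injective p≡q) p≢q
  ... | tri> _ _ q<p =
    let D , qp∈D = reverse-segment q p q<p (A-sym prev~prev) (A-sym p~q) in D , EdgeOf-sym {C = D} qp∈D

lemma5p2 : (h : ℕ) → 1 ≤ h → (t s : Fin h → ℕ) → (∀ i → 1 ≤ t i) → (∀ i → 1 ≤ s i)
    → HamCycle (Adj h t s)
    → (u v : Vtx h t s) → Adj h t s u v → KeyEdge h t s u v
    → Σ (HamCycle (Adj h t s)) (λ C → EdgeOf C u v)
lemma5p2 h _ t s _ _ C u v u~v key
  with p , refl ← injective⇒surjective (HamCycle.inj C) u
     | q , refl ← injective⇒surjective (HamCycle.inj C) v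
  = two-opt Adj-sym C p q (λ { refl → Adj-irrefl u~v }) (Adj-sym prev~prev) u~v
  where
  open ChainGraph h t s
  prev~prev : Adj h t s (HamCycle.cyc C (cprev q)) (HamCycle.cyc C (cprev p))
  prev~prev = key-edge-neighbours-adjacent key (cycle-edge C (cprev-Next q)) (Adj-sym (cycle-edge C (cprev-Next p)))
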